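{- Let $w$ be a word with $s_1(w)=s_2(w)=2$ (a 2FS square), and let $sq_1,SQ_1$ (resp. $sq_2,SQ_2$) be the roots of the two squares whose last occurrence in $w$ starts at location 1 (resp. 2), with $|sq_1|<|SQ_1|$ and $|sq_2|<|SQ_2|$. Then $SQ_1^2$ and $SQ_2^2$ are conjugates if and only if $sq_1^2$ and $sq_2^2$ are conjugates.
   Context: Words $w,w'$ are conjugates if $w=uv$ and $w'=vu$ for some words $u,v$. A square is a word $uu$ with $u$ nonempty; $u$ is its root. A square $uu$ occurs at location $k$ of $w=a_1\cdots a_n$ if $a_k\cdots a_{k+2|u|-1}=uu$. $s_k(w)$ is the number of distinct squares occurring at location $k$ of $w$ but at no location $k'>k$. It is known that $s_k(w)\le 2$. When $s_k(w)=2$, the two such squares are denoted $sq_k^2$ and $SQ_k^2$ with $|sq_k|<|SQ_k|$. -}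

module Defs where

open import Data.Nat using (ℕ; suc; _<_; _≤_)
open import Data.List using (List; []; _∷_; _++_; drop; length)
open import Data.Product using (Σ; ∃; ∃-syntax; _×_)
open import Data.Sum using (_⊎_)
open import Relation.Nullary using (¬_)
open import Relation.Binary.PropositionalEquality using (_≡_; _≢_)

Conjugate : {A : Set} → List A → List A → Set
Conjugate w w' = ∃[ u ] ∃[ v ] (w ≡ u ++ v × w' ≡ v ++ u)

-- The square uu (u nonempty) occurs at location k (1-indexed) of w,
-- i.e. a_k ... a_{k+2|u|-1} = uu.
OccursAt : {A : Set} → List A → ℕ → List A → Set
OccursAt w k u = 1 ≤ k × u ≢ [] × ∃[ rest ] (drop (Data.Nat.pred k) w ≡ u ++ u ++ rest)

LastOccAt : {A : Set} → List A → ℕ → List A → Set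
LastOccAt w k u = OccursAt w k u × (∀ k' → k < k' → ¬ OccursAt w k' u)

-- s_k(w) = 2, with the two squares being sq² and SQ², |sq| < |SQ|:
-- exactly the squares sq² and SQ² have their last occurrence at location k.
-- (A square uu is determined by its root u.)
TwoSquaresAt : {A : Set} → List A → ℕ → List A → List A → Set
TwoSquaresAt w k sq SQ =
  LastOccAt w k sq × LastOccAt w k SQ × length sq < length SQ ×
  (∀ u → LastOccAt w k u → u ≡ sq ⊎ u ≡ SQ)

module Submission where

-- Conjugate squares have roots of equal length, and squares u² and v² starting at positions 0 and 1
-- with |u| = |v| are conjugate, so the claim is |SQ₁| = |SQ₂| ⟺ |sq₁| = |sq₂|.  If exactly one of these
-- equalities held, subtracting the periods of two squares with equal or neighbouring starts would give
-- difference periods on two overlapping windows; Fine–Wilf merges them into one period g, and the period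
-- of a long square carries g back to the start of a short square.  That square then occurs again further
-- to the right, contradicting that its last occurrence is at location 1 or 2.  The same
-- rightmost-occurrence property gives |SQ| < 2 |sq| at each location, which makes the windows long enough.

open import Defs

open import Data.Nat using (ℕ; zero; suc; _+_; _*_; _≤_; _<_; _≤?_; _<?_; z≤n; s≤s; >-nonZero)
open import Data.Nat.Properties
open import Data.Nat.Divisibility using (_∣_; divides; _∣0; ∣-refl; ∣m∣n⇒∣m+n; ∣m+n∣m⇒∣n; ∣⇒≤)
open import Data.Nat.GCD using (gcd; gcd[m,n]∣m; gcd[m,n]∣n; gcd-greatest; gcd-comm; gcd[m,n]≡0⇒n≡0)
open import Data.Nat.Induction using (<-wellFounded)
open import Data.Nat.Tactic.RingSolver using (solve)
open import Algebra.Properties.CommutativeSemigroup +-commutativeSemigroup using (xy∙z≈xz∙y)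
open import Data.List using (List; []; _∷_; _++_; [_]; drop; head; length)
open import Data.List.Properties
  using (drop-drop; length-++; length-++-comm; ++-assoc; ∷-injectiveˡ; ∷-injectiveʳ)
open import Data.Maybe using (Maybe)
open import Data.Product using (∃-syntax; _×_; _,_; map₂)
open import Induction.WellFounded using (Acc; acc)
open import Relation.Binary using (tri<; tri≈; tri>)
open import Relation.Binary.PropositionalEquality
  using (_≡_; _≢_; refl; sym; trans; cong; cong₂; subst; module ≡-Reasoning)
open import Relation.Nullary using (¬_; yes; no)
open import Data.Empty using (⊥-elim)

m<n⇒∃[o]m+[1+o]≡n : ∀ {m n} → m < n → ∃[ o ] m + suc o ≡ n
m<n⇒∃[o]m+[1+o]≡n {m} m<n with m≤n⇒∃[o]m+o≡n m<n
... | o , eq = o , trans (+-suc m o) eq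

m+o≡n⇒m≤n : ∀ {m n} o → m + o ≡ n → m ≤ n
m+o≡n⇒m≤n {m} o refl = m≤m+n m o

m≤1+n⇒m≤n+o : ∀ {m n o} → m ≤ suc n → 1 ≤ o → m ≤ n + o
m≤1+n⇒m≤n+o {n = n} m≤1+n 1≤o = ≤-trans m≤1+n (≤-trans (≤-reflexive (+-comm 1 n)) (+-monoʳ-≤ n 1≤o))

m+n≤1+o⇒m≤o : ∀ {m n o} → 1 ≤ n → m + n ≤ suc o → m ≤ o
m+n≤1+o⇒m≤o {m} {suc n} _ m+n≤1+o =
  m+n≤o⇒m≤o m (≤-pred (≤-trans (≤-reflexive (sym (+-suc m n))) m+n≤1+o))

∣⇒≤′ : ∀ {m n} → 1 ≤ n → m ∣ n → m ≤ n
∣⇒≤′ 1≤n = ∣⇒≤ {{>-nonZero 1≤n}}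

a+m+n≤b+[n+n] : ∀ {a b m n} → a ≤ suc b → m < n → a + m + n ≤ b + (n + n)
a+m+n≤b+[n+n] {a} {b} {m} {n} a≤1+b m<n = begin
  a + m + n       ≤⟨ +-monoˡ-≤ n (+-monoˡ-≤ m a≤1+b) ⟩
  suc b + m + n   ≡⟨ cong (_+ n) (sym (+-suc b m)) ⟩
  b + suc m + n   ≤⟨ +-monoˡ-≤ n (+-monoʳ-≤ b m<n) ⟩
  b + n + n       ≡⟨ +-assoc b n n ⟩
  b + (n + n)     ∎
  where open ≤-Reasoning

m+m≡n+n⇒m≡n : ∀ {m n} → m + m ≡ n + n → m ≡ n
m+m≡n+n⇒m≡n {zero} {zero} _ = refl
m+m≡n+n⇒m≡n {suc m} {suc n} eq =
  cong suc (m+m≡n+n⇒m≡n (suc-injective (trans (sym (+-suc m m)) (trans (suc-injective eq) (+-suc n n)))))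

1≤gcd : ∀ m {n} → 1 ≤ n → 1 ≤ gcd m n
1≤gcd m {suc n} _ = n≢0⇒n>0 (λ gcd≡0 → 0≢1+n (sym (gcd[m,n]≡0⇒n≡0 m gcd≡0)))

module Periodicity {X : Set} (f : ℕ → X) where

  Periodic : ℕ → ℕ → ℕ → Set
  Periodic p l r = ∀ i → l ≤ i → i + p < r → f i ≡ f (i + p)

  periodic-restrict : ∀ {p l r l' r'} → l ≤ l' → r' ≤ r → Periodic p l r → Periodic p l' r'
  periodic-restrict l≤l' r'≤r P i l'≤i i+p<r' = P i (≤-trans l≤l' l'≤i) (≤-trans i+p<r' r'≤r)

  periodic-* : ∀ {p l r} k → Periodic p l r → Periodic (k * p) l r
  periodic-* zero P i _ _ = cong f (sym (+-identityʳ i))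
  periodic-* {p} {r = r} (suc k) P i l≤i i+p+kp<r = begin
    f i                 ≡⟨ P i l≤i (≤-<-trans (m≤m+n (i + p) (k * p)) i+p+kp<r′) ⟩
    f (i + p)           ≡⟨ periodic-* k P (i + p) (≤-trans l≤i (m≤m+n i p)) i+p+kp<r′ ⟩
    f (i + p + k * p)   ≡⟨ cong f (+-assoc i p (k * p)) ⟩
    f (i + (p + k * p)) ∎
    where
    open ≡-Reasoning
    i+p+kp<r′ : i + p + k * p < r
    i+p+kp<r′ = subst (_< r) (sym (+-assoc i p (k * p))) i+p+kp<r

  periodic-∣ : ∀ {p q l r} → p ∣ q → Periodic p l r → Periodic q l r
  periodic-∣ (divides k refl) = periodic-* k

  periodic-glue : ∀ {p l r l' r'} → l' + p ≤ r → Periodic p l r → Periodic p l' r' → Periodic p l r'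
  periodic-glue {p} {r = r} {l'} l'+p≤r P Q i l≤i i+p<r' with i + p <? r
  ... | yes i+p<r = P i l≤i i+p<r
  ... | no  i+p≮r = Q i (+-cancelʳ-≤ p l' i (≤-trans l'+p≤r (≮⇒≥ i+p≮r))) i+p<r'

  -- f j = f (j - a) = f (j + d)
  periodic-difference : ∀ {a d l r l' r' r''} → l' ≤ l → r'' ≤ r + d → r'' ≤ r' →
    Periodic a l r → Periodic (a + d) l' r' → Periodic d (l + a) r''
  periodic-difference {a} {d} {l} {r} {r'' = r''} l'≤l r''≤r+d r''≤r' P Q j l+a≤j j+d<r''
    with m≤n⇒∃[o]m+o≡n l+a≤j
  ... | o , refl = begin
    f (l + a + o)       ≡⟨ cong f (solve (l ∷ a ∷ o ∷ [])) ⟩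
    f (l + o + a)       ≡⟨ P (l + o) (m≤m+n l o) (+-cancelʳ-< d _ r (≤-trans shifted-a r''≤r+d)) ⟨
    f (l + o)           ≡⟨ Q (l + o) (≤-trans l'≤l (m≤m+n l o)) (≤-trans shifted-ad r''≤r') ⟩
    f (l + o + (a + d)) ≡⟨ cong f shift-ad ⟩
    f (l + a + o + d)   ∎
    where
    open ≡-Reasoning
    shift-a : l + a + o + d ≡ l + o + a + d
    shift-a = solve (l ∷ a ∷ o ∷ d ∷ [])
    shift-ad : l + o + (a + d) ≡ l + a + o + d
    shift-ad = solve (l ∷ a ∷ o ∷ d ∷ [])
    shifted-a : l + o + a + d < r''
    shifted-a = subst (_< r'') shift-a j+d<r''
    shifted-ad : l + o + (a + d) < r''
    shifted-ad = subst (_< r'') (sym shift-ad) j+d<r''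

  periodic-extendˡ-∣ : ∀ {p P l l' r} → p ∣ P → 1 ≤ P → l' + P ≤ r →
    Periodic P l r → Periodic p l' r → Periodic p l r
  periodic-extendˡ-∣ {p} {_} {l} {l'} {r} (divides (suc k) refl) 1≤P l'+P≤r PP Pp i l≤i =
    go l' i (m≤m+n l' i) l≤i
    where
    open ≡-Reasoning
    P : ℕ
    P = p + k * p
    jump : ∀ {i} → i < l' → i + P < r
    jump i<l' = ≤-trans (+-monoˡ-< P i<l') l'+P≤r
    go : ∀ n i → l' ≤ n + i → l ≤ i → i + p < r → f i ≡ f (i + p)
    go zero i l'≤i _ i+p<r = Pp i l'≤i i+p<r
    go (suc n) i l'≤1+n+i l≤i i+p<r with l' ≤? i | l' ≤? i + p
    ... | yes l'≤i | _ = Pp i l'≤i i+p<r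
    ... | no l'≰i | yes l'≤i+p = begin
      f i               ≡⟨ PP i l≤i (jump (≰⇒> l'≰i)) ⟩
      f (i + P)         ≡⟨ cong f (+-assoc i p (k * p)) ⟨
      f (i + p + k * p) ≡⟨ periodic-* k Pp (i + p) l'≤i+p i+p+kp<r ⟨
      f (i + p)         ∎
      where
      i+p+kp<r : i + p + k * p < r
      i+p+kp<r = subst (_< r) (sym (+-assoc i p (k * p))) (jump (≰⇒> l'≰i))
    ... | no l'≰i | no l'≰i+p = begin
      f i           ≡⟨ PP i l≤i (jump (≰⇒> l'≰i)) ⟩
      f (i + P)     ≡⟨ go n (i + P) fuel (≤-trans l≤i (m≤m+n i P)) i+P+p<r ⟩
      f (i + P + p) ≡⟨ cong f (xy∙z≈xz∙y i P p) ⟩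
      f (i + p + P) ≡⟨ PP (i + p) (≤-trans l≤i (m≤m+n i p)) (jump (≰⇒> l'≰i+p)) ⟨
      f (i + p)     ∎
      where
      i+P+p<r : i + P + p < r
      i+P+p<r = subst (_< r) (xy∙z≈xz∙y i p P) (jump (≰⇒> l'≰i+p))
      fuel : l' ≤ n + (i + P)
      fuel = ≤-trans l'≤1+n+i (≤-trans (≤-reflexive (sym (+-suc n i))) (+-monoʳ-≤ n (m<m+n i 1≤P)))

  periodic-extendʳ-∣ : ∀ {p P l r r'} → p ∣ P → 1 ≤ P → l + P ≤ r' →
    Periodic P l r → Periodic p l r' → Periodic p l r
  periodic-extendʳ-∣ {p} {_} {l} {r} {r'} (divides (suc k) refl) 1≤P l+P≤r' PP Pp i =
    go i (<-wellFounded i)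
    where
    open ≡-Reasoning
    P : ℕ
    P = p + k * p
    e₀ : l + k * p + p ≡ l + (p + k * p)
    e₀ = solve (l ∷ p ∷ k ∷ [])
    go : ∀ i → Acc _<_ i → l ≤ i → i + p < r → f i ≡ f (i + p)
    go i (acc rec) l≤i i+p<r with i + p <? r' | l + P ≤? i
    ... | yes i+p<r' | _ = Pp i l≤i i+p<r'
    ... | no _ | yes l+P≤i with m≤n⇒∃[o]m+o≡n l+P≤i
    ...   | o , refl = begin
      f (l + P + o)     ≡⟨ cong f e₁ ⟨
      f (j + P)         ≡⟨ PP j l≤j (subst (_< r) (sym e₁) (≤-<-trans (m≤m+n _ p) i+p<r)) ⟨
      f j               ≡⟨ go j (rec j<i) l≤j (≤-<-trans (m≤m+n (j + p) P) j+p+P<r) ⟩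
      f (j + p)         ≡⟨ PP (j + p) (≤-trans l≤j (m≤m+n j p)) j+p+P<r ⟩
      f (j + p + P)     ≡⟨ cong f e₂ ⟩
      f (l + P + o + p) ∎
      where
      j : ℕ
      j = l + o
      l≤j : l ≤ j
      l≤j = m≤m+n l o
      e₁ : l + o + (p + k * p) ≡ l + (p + k * p) + o
      e₁ = solve (l ∷ o ∷ p ∷ k ∷ [])
      e₂ : l + o + p + (p + k * p) ≡ l + (p + k * p) + o + p
      e₂ = solve (l ∷ o ∷ p ∷ k ∷ [])
      j<i : j < l + P + o
      j<i = subst (j <_) e₁ (m<m+n j 1≤P)
      j+p+P<r : j + p + P < r
      j+p+P<r = subst (_< r) (sym e₂) i+p<r
    go i (acc rec) l≤i i+p<r | no i+p≮r' | no l+P≰i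
      with m≤n⇒∃[o]m+o≡n (+-cancelʳ-≤ p (l + k * p) i (≤-trans (≤-reflexive e₀) (≤-trans l+P≤r' (≮⇒≥ i+p≮r'))))
    ...   | o , refl = begin
      f (l + k * p + o) ≡⟨ cong f (xy∙z≈xz∙y l (k * p) o) ⟩
      f (j + k * p)     ≡⟨ periodic-* k Pp j l≤j j+kp<r' ⟨
      f j               ≡⟨ PP j l≤j (subst (_< r) (sym e) i+p<r) ⟩
      f (j + P)         ≡⟨ cong f e ⟩
      f (l + k * p + o + p) ∎
      where
      j : ℕ
      j = l + o
      l≤j : l ≤ j
      l≤j = m≤m+n l o
      e : l + o + (p + k * p) ≡ l + k * p + o + p
      e = solve (l ∷ o ∷ p ∷ k ∷ [])
      j+kp<r' : j + k * p < r'
      j+kp<r' = subst (_< r') (xy∙z≈xz∙y l (k * p) o) (≤-trans (≰⇒> l+P≰i) l+P≤r')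

  -- Euclid's subtraction step: q - p is a period on [l + p, r), and since gcd p (q - p) divides p
  -- the p-periodicity carries it back to [l, r)
  fine-wilf-step : ∀ {p q l r} → p ≤ q → 1 ≤ p → l + p + q ≤ suc r → Periodic p l r → Periodic q l r →
    (∀ {d} → p + d < p + q → 1 ≤ d → l + p + p + d ≤ suc r →
      Periodic p (l + p) r → Periodic d (l + p) r → Periodic (gcd p d) (l + p) r) →
    Periodic (gcd p q) l r
  fine-wilf-step {p} {l = l} {r} p≤q 1≤p bound P Q IH with m≤n⇒∃[o]m+o≡n p≤q
  ... | zero , refl = periodic-∣ (gcd-greatest ∣-refl (∣m∣n⇒∣m+n ∣-refl (p ∣0))) P
  ... | suc d , refl =
    periodic-∣ (gcd-greatest g∣p (∣m∣n⇒∣m+n g∣p (gcd[m,n]∣n p (suc d))))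
      (periodic-extendˡ-∣ g∣p 1≤p l+p+p≤r P
        (IH (m<n+m _ 1≤p) (s≤s z≤n) (≤-trans (≤-reflexive (+-assoc (l + p) p (suc d))) bound)
          (periodic-restrict (m≤m+n l p) ≤-refl P)
          (periodic-difference ≤-refl (m≤m+n r (suc d)) ≤-refl P Q)))
    where
    g∣p : gcd p (suc d) ∣ p
    g∣p = gcd[m,n]∣m p (suc d)
    e : suc (l + p + p + d) ≡ l + p + (p + suc d)
    e = solve (l ∷ p ∷ d ∷ [])
    l+p+p≤r : l + p + p ≤ r
    l+p+p≤r = m+n≤o⇒m≤o (l + p + p) (≤-pred (≤-trans (≤-reflexive e) bound))

  fine-wilf : ∀ {p q l r} → 1 ≤ p → 1 ≤ q → l + p + q ≤ suc r →
    Periodic p l r → Periodic q l r → Periodic (gcd p q) l r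
  fine-wilf {p} {q} = go (<-wellFounded (p + q))
    where
    go : ∀ {p q l r} → Acc _<_ (p + q) → 1 ≤ p → 1 ≤ q → l + p + q ≤ suc r →
      Periodic p l r → Periodic q l r → Periodic (gcd p q) l r
    go {p} {q} {l} {r} (acc rec) 1≤p 1≤q bound P Q with p ≤? q
    ... | yes p≤q = fine-wilf-step p≤q 1≤p bound P Q (λ lt → go (rec lt) 1≤p)
    ... | no p≰q = subst (λ g → Periodic g l r) (gcd-comm q p)
      (fine-wilf-step (<⇒≤ (≰⇒> p≰q)) 1≤q (≤-trans (≤-reflexive (xy∙z≈xz∙y l q p)) bound) Q P
        (λ {d} lt → go (rec (subst (q + d <_) (+-comm q p) lt)) 1≤q))

  periodic-overlap : ∀ {p q l₁ r₁ l₂ r₂} → 1 ≤ p → 1 ≤ q →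
    l₁ ≤ l₂ → r₁ ≤ r₂ → l₂ + p + q ≤ suc r₁ → Periodic p l₁ r₁ → Periodic q l₂ r₂ → Periodic (gcd p q) l₁ r₂
  periodic-overlap {p} {q} {r₁ = r₁} {l₂} 1≤p 1≤q l₁≤l₂ r₁≤r₂ bound P Q =
    periodic-glue (≤-trans (+-monoʳ-≤ l₂ (∣⇒≤′ 1≤p (gcd[m,n]∣m p q))) l₂+p≤r₁)
      (periodic-extendˡ-∣ (gcd[m,n]∣m p q) 1≤p l₂+p≤r₁ P G)
      (periodic-extendʳ-∣ (gcd[m,n]∣n p q) 1≤q l₂+q≤r₁ Q G)
    where
    G : Periodic (gcd p q) l₂ r₁
    G = fine-wilf 1≤p 1≤q bound (periodic-restrict l₁≤l₂ ≤-refl P) (periodic-restrict ≤-refl r₁≤r₂ Q)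
    l₂+p≤r₁ : l₂ + p ≤ r₁
    l₂+p≤r₁ = m+n≤1+o⇒m≤o 1≤q bound
    l₂+q≤r₁ : l₂ + q ≤ r₁
    l₂+q≤r₁ = m+n≤1+o⇒m≤o 1≤p (≤-trans (≤-reflexive (xy∙z≈xz∙y l₂ q p)) bound)

  periodic-extendˡ : ∀ {p P l l' r} → 1 ≤ p → 1 ≤ P → l ≤ l' → l' + p + P ≤ suc r →
    Periodic P l r → Periodic p l' r → Periodic (gcd p P) l r
  periodic-extendˡ {p} {P} {l' = l'} {r} 1≤p 1≤P l≤l' bound PP Pp =
    periodic-extendˡ-∣ (gcd[m,n]∣n p P) 1≤P l'+P≤r PP
      (fine-wilf 1≤p 1≤P bound Pp (periodic-restrict l≤l' ≤-refl PP))
    where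
    l'+P≤r : l' + P ≤ r
    l'+P≤r = m+n≤1+o⇒m≤o 1≤p (≤-trans (≤-reflexive (xy∙z≈xz∙y l' P p)) bound)

  Square : ℕ → ℕ → Set
  Square n k = Periodic n k (k + (n + n))

  -- the factor of length 2n at position k occurs again h positions later
  Recurs : ℕ → ℕ → Set
  Recurs n k = ∃[ h ] (1 ≤ h × Periodic h k (k + (n + n) + h))

  recurs-by-extension : ∀ {g N n b l r} → 1 ≤ g → 1 ≤ N →
    b ≤ l → l + g + N ≤ suc r → r ≤ b + (N + N) → b + (n + n) + g ≤ r →
    Square N b → Periodic g l r → Recurs n b
  recurs-by-extension {g} {N} 1≤g 1≤N b≤l bound r≤end end≤ SN G =
    gcd g N , 1≤gcd g 1≤N ,
    periodic-restrict ≤-refl (≤-trans (+-monoʳ-≤ _ (∣⇒≤′ 1≤g (gcd[m,n]∣m g N))) end≤)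
      (periodic-extendˡ 1≤g 1≤N b≤l bound (periodic-restrict ≤-refl r≤end SN) G)

  square-difference : ∀ {n d k} → Square n k → Square (n + d) k → Periodic d (k + n) (k + n + (n + d))
  square-difference {n} {d} {k} = periodic-difference ≤-refl (≤-reflexive e₁) (m+o≡n⇒m≤n d e₂)
    where
    e₁ : k + n + (n + d) ≡ k + (n + n) + d
    e₁ = solve (k ∷ n ∷ d ∷ [])
    e₂ : k + n + (n + d) + d ≡ k + ((n + d) + (n + d))
    e₂ = solve (k ∷ n ∷ d ∷ [])

  nested-squares-periodic : ∀ {n p q a b} → 1 ≤ p → 1 ≤ q → p + q ≤ n → b ≤ suc a → a ≤ suc b →
    Square n a → Square (n + p) a → Square (n + p + q) b →
    Periodic (gcd p q) (a + n) (a + (n + p) + (n + p + q))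
  nested-squares-periodic {n} {p} {suc q} {a} 1≤p (s≤s z≤n) p+q≤n b≤1+a a≤1+b Sn SM SL =
    periodic-overlap 1≤p (s≤s z≤n) (m+o≡n⇒m≤n (suc p) e₁) (m+o≡n⇒m≤n (p + suc q) e₂) bound
      (square-difference Sn SM)
      (periodic-difference b≤1+a (≤-reflexive e₃) (a+m+n≤b+[n+n] a≤1+b (m<m+n M (s≤s z≤n)))
        (periodic-restrict (n≤1+n a) ≤-refl SM) SL)
    where
    M : ℕ
    M = n + p
    e₁ : a + n + suc p ≡ suc a + (n + p)
    e₁ = solve (a ∷ n ∷ p ∷ [])
    e₂ : a + n + (n + p) + (p + suc q) ≡ a + (n + p) + (n + p + suc q)
    e₂ = solve (a ∷ n ∷ p ∷ q ∷ [])
    e₃ : a + (n + p) + (n + p + suc q) ≡ a + ((n + p) + (n + p)) + suc q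
    e₃ = solve (a ∷ n ∷ p ∷ q ∷ [])
    e₄ : suc a + (n + p) + p + suc q ≡ suc (a + (n + p) + (p + suc q))
    e₄ = solve (a ∷ n ∷ p ∷ q ∷ [])
    bound : suc a + M + p + suc q ≤ suc (a + n + M)
    bound = begin
      suc a + M + p + suc q     ≡⟨ e₄ ⟩
      suc (a + M + (p + suc q)) ≤⟨ s≤s (+-monoʳ-≤ (a + M) p+q≤n) ⟩
      suc (a + M + n)           ≡⟨ cong suc (xy∙z≈xz∙y a M n) ⟩
      suc (a + n + M)           ∎
      where open ≤-Reasoning

  recurs-beside-nested-squares : ∀ {n M L a b} → b ≤ suc a → a ≤ suc b → n < M → M < L → L ≤ n + n →
    Square n a → Square M a → Square L b → Recurs n b
  recurs-beside-nested-squares {n} {_} {_} {a} {b} b≤1+a a≤1+b n<M M<L L≤2n Sn SM SL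
    with m<n⇒∃[o]m+[1+o]≡n n<M
  ... | p , refl with m<n⇒∃[o]m+[1+o]≡n M<L
  ...   | q , refl =
    recurs-by-extension {n = n} (1≤gcd (suc p) (s≤s z≤n)) 1≤L
      (m≤1+n⇒m≤n+o b≤1+a (≤-trans (s≤s z≤n) p+q≤n)) bound (a+m+n≤b+[n+n] a≤1+b (m<m+n M (s≤s z≤n))) end≤ SL
      (nested-squares-periodic (s≤s z≤n) (s≤s z≤n) p+q≤n b≤1+a a≤1+b Sn SM SL)
    where
    M L g : ℕ
    M = n + suc p
    L = M + suc q
    g = gcd (suc p) (suc q)
    1≤L : 1 ≤ L
    1≤L = ≤-trans (s≤s z≤n) (m≤n+m (suc q) M)
    p+q≤n : suc p + suc q ≤ n
    p+q≤n = +-cancelˡ-≤ n _ _ (≤-trans (≤-reflexive (sym (+-assoc n (suc p) (suc q)))) L≤2n)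
    g≤p : g ≤ suc p
    g≤p = ∣⇒≤′ (s≤s z≤n) (gcd[m,n]∣m (suc p) (suc q))
    bound : a + n + g + L ≤ suc (a + M + L)
    bound = begin
      a + n + g + L       ≤⟨ +-monoˡ-≤ L (+-monoʳ-≤ (a + n) g≤p) ⟩
      a + n + suc p + L   ≡⟨ cong (_+ L) (+-assoc a n (suc p)) ⟩
      a + M + L           ≤⟨ n≤1+n _ ⟩
      suc (a + M + L)     ∎
      where open ≤-Reasoning
    e : suc a + (n + n) + suc p + suc (p + q) ≡ a + (n + suc p) + (n + suc p + suc q)
    e = solve (a ∷ n ∷ p ∷ q ∷ [])
    end≤ : b + (n + n) + g ≤ a + M + L
    end≤ = ≤-trans (+-mono-≤ (+-monoˡ-≤ (n + n) b≤1+a) g≤p) (m+o≡n⇒m≤n (suc (p + q)) e)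

  twin-squares-periodic : ∀ {n c q a₁ a₂} → 1 ≤ c → 1 ≤ q → c + q ≤ n →
    a₁ ≤ suc a₂ → a₂ ≤ suc a₁ → Square n a₁ → Square (n + c) a₂ → Square (n + c + q) a₁ → Square (n + c + q) a₂ →
    Periodic (gcd (q + c) q) (a₁ + n) (a₂ + (n + c) + (n + c + q))
  twin-squares-periodic {n} {suc c} {q} {a₁} {a₂} (s≤s z≤n) 1≤q c+q≤n a₁≤1+a₂ a₂≤1+a₁
                        Sn₁ Sn₂ SN₁ SN₂ =
    periodic-overlap (≤-trans 1≤q (m≤m+n q (suc c))) 1≤q l₁≤l₂ r₁≤r₂ bound
      (square-difference Sn₁ (subst (λ N → Square N a₁) e₁ SN₁)) (square-difference Sn₂ SN₂)
    where
    N : ℕ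
    N = n + suc c + q
    e₁ : n + suc c + q ≡ n + (q + suc c)
    e₁ = solve (n ∷ c ∷ q ∷ [])
    l₁≤l₂ : a₁ + n ≤ a₂ + (n + suc c)
    l₁≤l₂ = ≤-trans (+-monoˡ-≤ n a₁≤1+a₂) (m+o≡n⇒m≤n c e₀)
      where
      e₀ : suc a₂ + n + c ≡ a₂ + (n + suc c)
      e₀ = solve (a₂ ∷ n ∷ c ∷ [])
    r₁≤r₂ : a₁ + n + (n + (q + suc c)) ≤ a₂ + (n + suc c) + N
    r₁≤r₂ = ≤-trans (≤-reflexive (cong (a₁ + n +_) (sym e₁))) (+-monoˡ-≤ N l₁≤l₂)
    e₂ : a₂ + (n + suc c) + (q + suc c) + q ≡ a₂ + (suc c + q) + (n + suc c + q)
    e₂ = solve (a₂ ∷ n ∷ c ∷ q ∷ [])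
    e₃ : suc a₁ + n + (n + suc c + q) ≡ suc (a₁ + n + (n + (q + suc c)))
    e₃ = solve (a₁ ∷ n ∷ c ∷ q ∷ [])
    bound : a₂ + (n + suc c) + (q + suc c) + q ≤ suc (a₁ + n + (n + (q + suc c)))
    bound = begin
      a₂ + (n + suc c) + (q + suc c) + q   ≡⟨ e₂ ⟩
      a₂ + (suc c + q) + N                 ≤⟨ +-monoˡ-≤ N (+-mono-≤ a₂≤1+a₁ c+q≤n) ⟩
      suc a₁ + n + N                       ≡⟨ e₃ ⟩
      suc (a₁ + n + (n + (q + suc c)))     ∎
      where open ≤-Reasoning

  recurs-under-twin-squares : ∀ {n₁ n₂ N a₁ a₂} → a₁ ≤ suc a₂ → a₂ ≤ suc a₁ →
    n₁ < n₂ → n₂ < N → N ≤ n₁ + n₁ → Square n₁ a₁ → Square n₂ a₂ → Square N a₁ → Square N a₂ → Recurs n₂ a₂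
  recurs-under-twin-squares {n₁} {_} {_} {a₁} {a₂} a₁≤1+a₂ a₂≤1+a₁ n₁<n₂ n₂<N N≤2n₁ Sn₁ Sn₂ SN₁ SN₂
    with m<n⇒∃[o]m+[1+o]≡n n₁<n₂
  ... | c , refl with m<n⇒∃[o]m+[1+o]≡n n₂<N
  ...   | q , refl =
    recurs-by-extension {n = n₂} (1≤gcd (suc q + suc c) (s≤s z≤n)) 1≤N
      (m≤1+n⇒m≤n+o a₂≤1+a₁ (≤-trans (s≤s z≤n) c+q≤n₁)) bound (a+m+n≤b+[n+n] (n≤1+n a₂) (m<m+n n₂ (s≤s z≤n)))
      end≤ SN₂
      (twin-squares-periodic (s≤s z≤n) (s≤s z≤n) c+q≤n₁ a₁≤1+a₂ a₂≤1+a₁ Sn₁ Sn₂ SN₁ SN₂)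
    where
    n₂ N g : ℕ
    n₂ = n₁ + suc c
    N = n₂ + suc q
    g = gcd (suc q + suc c) (suc q)
    1≤N : 1 ≤ N
    1≤N = ≤-trans (s≤s z≤n) (m≤n+m (suc q) n₂)
    c+q≤n₁ : suc c + suc q ≤ n₁
    c+q≤n₁ = +-cancelˡ-≤ n₁ _ _ (≤-trans (≤-reflexive (sym (+-assoc n₁ (suc c) (suc q)))) N≤2n₁)
    g∣q : g ∣ suc q
    g∣q = gcd[m,n]∣n (suc q + suc c) (suc q)
    g≤c : g ≤ suc c
    g≤c = ∣⇒≤′ (s≤s z≤n) (∣m+n∣m⇒∣n (gcd[m,n]∣m (suc q + suc c) (suc q)) g∣q)
    g≤q : g ≤ suc q
    g≤q = ∣⇒≤′ (s≤s z≤n) g∣q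
    bound : a₁ + n₁ + g + N ≤ suc (a₂ + n₂ + N)
    bound = begin
      a₁ + n₁ + g + N             ≤⟨ +-monoˡ-≤ N (+-mono-≤ (+-monoˡ-≤ n₁ a₁≤1+a₂) g≤c) ⟩
      suc a₂ + n₁ + suc c + N     ≡⟨ cong (λ x → suc x + N) (+-assoc a₂ n₁ (suc c)) ⟩
      suc (a₂ + n₂ + N)           ∎
      where open ≤-Reasoning
    e : a₂ + ((n₁ + suc c) + (n₁ + suc c)) + suc q ≡ a₂ + (n₁ + suc c) + (n₁ + suc c + suc q)
    e = solve (a₂ ∷ n₁ ∷ c ∷ q ∷ [])
    end≤ : a₂ + (n₂ + n₂) + g ≤ a₂ + n₂ + N
    end≤ = ≤-trans (+-monoʳ-≤ (a₂ + (n₂ + n₂)) g≤q) (≤-reflexive e)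

  square-root-bound : ∀ {n N k} → 1 ≤ N → Square N k → ¬ Recurs n k → N < n + n
  square-root-bound {n} {N} {k} 1≤N SN ¬R with N <? n + n
  ... | yes N<2n = N<2n
  ... | no N≮2n = ⊥-elim (¬R (N , 1≤N , periodic-restrict ≤-refl end≤ SN))
    where
    end≤ : k + (n + n) + N ≤ k + (N + N)
    end≤ = ≤-trans (+-monoˡ-≤ N (+-monoʳ-≤ k (≮⇒≥ N≮2n))) (≤-reflexive (+-assoc k N N))

  module _ {s S t T} (Ss : Square s 0) (SS : Square S 0) (St : Square t 1) (ST : Square T 1)
           (s<S : s < S) (t<T : t < T) (¬Rs : ¬ Recurs s 0) (¬Rt : ¬ Recurs t 1) where

    private
      S<2s : S < s + s
      S<2s = square-root-bound {s} (≤-trans (s≤s z≤n) s<S) SS ¬Rs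
      T<2t : T < t + t
      T<2t = square-root-bound {t} (≤-trans (s≤s z≤n) t<T) ST ¬Rt

    long-roots-equal⇒short-roots-equal : S ≡ T → s ≡ t
    long-roots-equal⇒short-roots-equal refl with <-cmp s t
    ... | tri≈ _ s≡t _ = s≡t
    ... | tri< s<t _ _ = ⊥-elim (¬Rt (recurs-under-twin-squares z≤n (s≤s z≤n) s<t t<T (<⇒≤ S<2s) Ss St SS ST))
    ... | tri> _ _ t<s = ⊥-elim (¬Rs (recurs-under-twin-squares (s≤s z≤n) z≤n t<s s<S (<⇒≤ T<2t) St Ss ST SS))

    short-roots-equal⇒long-roots-equal : s ≡ t → S ≡ T
    short-roots-equal⇒long-roots-equal refl with <-cmp S T
    ... | tri≈ _ S≡T _ = S≡T
    ... | tri< S<T _ _ = ⊥-elim (¬Rt (recurs-beside-nested-squares (s≤s z≤n) z≤n s<S S<T (<⇒≤ T<2t) Ss SS ST))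
    ... | tri> _ _ T<S = ⊥-elim (¬Rs (recurs-beside-nested-squares z≤n (s≤s z≤n) t<T T<S (<⇒≤ S<2s) St ST SS))

module _ {A : Set} where

  -- positions are 0-based: location k of a word in the sense of Defs is position k - 1 here
  letter : List A → ℕ → Maybe A
  letter w i = head (drop i w)

  letter-++ˡ : ∀ (xs : List A) {ys i} → i < length xs → letter (xs ++ ys) i ≡ letter xs i
  letter-++ˡ (x ∷ xs) {i = zero} _ = refl
  letter-++ˡ (x ∷ xs) {i = suc i} (s≤s i<n) = letter-++ˡ xs i<n

  letter-++ʳ : ∀ (xs : List A) {ys} i → letter (xs ++ ys) (length xs + i) ≡ letter ys i
  letter-++ʳ [] i = refl
  letter-++ʳ (x ∷ xs) i = letter-++ʳ xs i

  letter-drop : ∀ k (w : List A) i → letter (drop k w) i ≡ letter w (k + i)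
  letter-drop k w i = cong head (drop-drop k i w)

  prefix-from-letters : ∀ (v z : List A) → (∀ i → i < length v → letter z i ≡ letter v i) →
    ∃[ r ] z ≡ v ++ r
  prefix-from-letters [] z _ = z , refl
  prefix-from-letters (x ∷ v) [] same with same 0 (s≤s z≤n)
  ... | ()
  prefix-from-letters (x ∷ v) (y ∷ z) same
    with same 0 (s≤s z≤n) | prefix-from-letters v z (λ i i<n → same (suc i) (s≤s i<n))
  ... | refl | r , z≡v++r = r , cong (y ∷_) z≡v++r

  open Periodicity

  square-at : ∀ {w r : List A} k u → drop k w ≡ u ++ u ++ r → Square (letter w) (length u) k
  square-at {w} {r} k u eq i k≤i i+n<end with m≤n⇒∃[o]m+o≡n k≤i
  ... | j , refl = begin
    letter w (k + j)              ≡⟨ letter-drop k w j ⟨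
    letter (drop k w) j           ≡⟨ cong (λ z → letter z j) eq ⟩
    letter (u ++ u ++ r) j        ≡⟨ letter-++ˡ u j<n ⟩
    letter u j                    ≡⟨ letter-++ˡ u j<n ⟨
    letter (u ++ r) j             ≡⟨ letter-++ʳ u j ⟨
    letter (u ++ u ++ r) (n + j)  ≡⟨ cong (λ z → letter z (n + j)) eq ⟨
    letter (drop k w) (n + j)     ≡⟨ letter-drop k w (n + j) ⟩
    letter w (k + (n + j))        ≡⟨ cong (letter w) (trans (cong (k +_) (+-comm n j)) (sym (+-assoc k j n))) ⟩
    letter w (k + j + n)          ∎
    where
    open ≡-Reasoning
    n : ℕ
    n = length u
    j<n : j < n
    j<n = +-cancelʳ-< n j n (+-cancelˡ-< k (j + n) (n + n) (subst (_< k + (n + n)) (+-assoc k j n) i+n<end))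

  recurring-square-occurs : ∀ {w r : List A} {k h} u → drop k w ≡ u ++ u ++ r →
    Periodic (letter w) h k (k + (length u + length u) + h) → ∃[ r' ] drop (k + h) w ≡ u ++ u ++ r'
  recurring-square-occurs {w} {r} {k} {h} u eq P =
    map₂ (λ eq' → trans eq' (++-assoc u u _)) (prefix-from-letters (u ++ u) (drop (k + h) w) same)
    where
    same : ∀ i → i < length (u ++ u) → letter (drop (k + h) w) i ≡ letter (u ++ u) i
    same i i<2n = begin
      letter (drop (k + h) w) i   ≡⟨ letter-drop (k + h) w i ⟩
      letter w (k + h + i)        ≡⟨ cong (letter w) (xy∙z≈xz∙y k h i) ⟩
      letter w (k + i + h)        ≡⟨ P (k + i) (m≤m+n k i) (+-monoˡ-< h (+-monoʳ-< k i<n+n)) ⟨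
      letter w (k + i)            ≡⟨ letter-drop k w i ⟨
      letter (drop k w) i         ≡⟨ cong (λ z → letter z i) (trans eq (sym (++-assoc u u r))) ⟩
      letter ((u ++ u) ++ r) i    ≡⟨ letter-++ˡ (u ++ u) i<2n ⟩
      letter (u ++ u) i           ∎
      where
      open ≡-Reasoning
      i<n+n : i < length u + length u
      i<n+n = subst (i <_) (length-++ u) i<2n

  last-square-does-not-recur : ∀ {w u : List A} {k} → LastOccAt w (suc k) u → ¬ Recurs (letter w) (length u) k
  last-square-does-not-recur {u = u} {k} ((_ , u≢[] , _ , eq) , never-later) (h , 1≤h , P) =
    never-later (suc k + h) (m<m+n (suc k) 1≤h) (s≤s z≤n , u≢[] , recurring-square-occurs u eq P)

  ++-injectiveˡ : ∀ (xs ys : List A) {zs ws} → length xs ≡ length ys → xs ++ zs ≡ ys ++ ws → xs ≡ ys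
  ++-injectiveˡ [] [] _ _ = refl
  ++-injectiveˡ (x ∷ xs) (y ∷ ys) |xs|≡|ys| eq =
    cong₂ _∷_ (∷-injectiveˡ eq) (++-injectiveˡ xs ys (suc-injective |xs|≡|ys|) (∷-injectiveʳ eq))

  conjugate-length : ∀ {w w' : List A} → Conjugate w w' → length w ≡ length w'
  conjugate-length (u , v , refl , refl) = length-++-comm u v

  conjugate-squares-root-length : ∀ (u v : List A) → Conjugate (u ++ u) (v ++ v) → length u ≡ length v
  conjugate-squares-root-length u v c =
    m+m≡n+n⇒m≡n (trans (sym (length-++ u)) (trans (conjugate-length c) (length-++ v)))

  adjacent-squares-conjugate : ∀ {w r r' : List A} u v → u ≢ [] →
    drop 0 w ≡ u ++ u ++ r → drop 1 w ≡ v ++ v ++ r' → length u ≡ length v → Conjugate (u ++ u) (v ++ v)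
  adjacent-squares-conjugate [] _ u≢[] = ⊥-elim (u≢[] refl)
  adjacent-squares-conjugate {r = r} (a ∷ u') v _ refl v² |u|≡|v| = [ a ] , u' ++ a ∷ u' , refl , (begin
    v ++ v                          ≡⟨ cong₂ _++_ v≡u'a v≡u'a ⟩
    (u' ++ [ a ]) ++ (u' ++ [ a ])  ≡⟨ ++-assoc u' [ a ] (u' ++ [ a ]) ⟩
    u' ++ (a ∷ u') ++ [ a ]         ≡⟨ ++-assoc u' (a ∷ u') [ a ] ⟨
    (u' ++ a ∷ u') ++ [ a ]         ∎)
    where
    open ≡-Reasoning
    v≡u'a : v ≡ u' ++ [ a ]
    v≡u'a = ++-injectiveˡ v (u' ++ [ a ]) (trans (sym |u|≡|v|) (length-++-comm [ a ] u'))
              (trans (sym v²) (sym (++-assoc u' [ a ] (u' ++ r))))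

corollary1 : {A : Set} (w sq₁ SQ₁ sq₂ SQ₂ : List A) →
    TwoSquaresAt w 1 sq₁ SQ₁ → TwoSquaresAt w 2 sq₂ SQ₂ →
    (Conjugate (SQ₁ ++ SQ₁) (SQ₂ ++ SQ₂) → Conjugate (sq₁ ++ sq₁) (sq₂ ++ sq₂)) ×
    (Conjugate (sq₁ ++ sq₁) (sq₂ ++ sq₂) → Conjugate (SQ₁ ++ SQ₁) (SQ₂ ++ SQ₂))
corollary1 w x X y Y (x-last@((_ , x≢[] , _ , x²) , _) , ((_ , X≢[] , _ , X²) , _) , s<S , _)
                     (y-last@((_ , _ , _ , y²) , _) , ((_ , _ , _ , Y²) , _) , t<T , _) =
    (λ c → adjacent-squares-conjugate x y x≢[] x² y² (long⇒short (conjugate-squares-root-length X Y c)))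
  , (λ c → adjacent-squares-conjugate X Y X≢[] X² Y² (short⇒long (conjugate-squares-root-length x y c)))
  where
  open Periodicity (letter w)
  Sx : Square (length x) 0
  Sx = square-at 0 x x²
  SX : Square (length X) 0
  SX = square-at 0 X X²
  Sy : Square (length y) 1
  Sy = square-at 1 y y²
  SY : Square (length Y) 1
  SY = square-at 1 Y Y²
  long⇒short : length X ≡ length Y → length x ≡ length y
  long⇒short = long-roots-equal⇒short-roots-equal Sx SX Sy SY s<S t<T
                 (last-square-does-not-recur x-last) (last-square-does-not-recur y-last)
  short⇒long : length x ≡ length y → length X ≡ length Y
  short⇒long = short-roots-equal⇒long-roots-equal Sx SX Sy SY s<S t<T
                 (last-square-does-not-recur x-last) (last-square-does-not-recur y-last)
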